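{- If $R$ is a consistent triple set, then $\min(\mathfrak{sc}(R))=\mathrm{MIN}(\mathfrak{sc}(R))$; that is, every inclusion-minimal representative subset of $R$ has minimum cardinality among all representative subsets of $R$ (and in particular all inclusion-minimal representative subsets of $R$ have the same cardinality).
   Context: Rooted trees: a rooted tree $T$ has a distinguished inner vertex $\rho_T$ (the root); leaves are the vertices of degree 1; every inner vertex other than the root has degree at least 3. A triple $ab|c$ is the rooted binary tree on three leaves $a,b,c$ in which the path from $a$ to $b$ does not meet the path from $c$ to the root; $ab|c=ba|c$. A rooted tree $T$ displays $ab|c$ if $a,b,c$ are leaves of $T$ and the path from $a$ to $b$ does not intersect the path from $c$ to $\rho_T$. $\mathcal R(T)$ is the set of triples displayed by $T$. A triple set $R$ is consistent if some rooted tree displays all of it. $L_R$ is the set of leaves occurring in triples of $R$. $\mathrm{span}(R)$ is the set of rooted trees with leaf set $L_R$ displaying $R$; $\mathrm{cl}(R)=\bigcap_{T\in\mathrm{span}(R)}\mathcal R(T)$. $\mathfrak{sc}(R)=\{R'\subseteq R:\mathrm{cl}(R')=\mathrm{cl}(R)\}$ (representative subsets); $\min(\mathfrak{sc}(R))$ is the set of inclusion-minimal elements of $\mathfrak{sc}(R)$; $\mathrm{MIN}(\mathfrak{sc}(R))=\{R'\in\mathfrak{sc}(R): |R'|\le|R''| \text{ for all } R''\in\mathfrak{sc}(R)\}$. -}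

module Defs where

open import Data.Nat using (ℕ; _≤_; _<ᵇ_; _≡ᵇ_)
open import Data.Bool using (T; not)
open import Data.List using (List; []; _∷_; length; _++_)
open import Data.List.Membership.Propositional using (_∈_; _∉_)
open import Data.List.Relation.Unary.All using (All)
open import Data.List.Relation.Unary.Unique.Propositional using (Unique)
open import Data.Product using (Σ; _×_; ∃; ∃-syntax)
open import Data.Sum using (_⊎_)
open import Relation.Binary.PropositionalEquality using (_≡_)
open import Function.Bundles using (_⇔_)

Label : Set
Label = ℕ

-- Triples ab|c on three distinct leaves.  Since ab|c = ba|c we store
-- the canonical representative with a < b; the guards are of the form
-- T b (values of type ⊤), so two triples are equal iff their labels are.

record Triple : Set where
  constructor triple
  field
    a b c : Label
    a<b   : T (a <ᵇ b)
    c≢a   : T (not (c ≡ᵇ a))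
    c≢b   : T (not (c ≡ᵇ b))

TripleSet : Set
TripleSet = List Triple

_⊆_ : TripleSet → TripleSet → Set
R ⊆ S = ∀ {t} → t ∈ R → t ∈ S

_∈L_ : Label → TripleSet → Set
x ∈L R = ∃[ t ] (t ∈ R × (x ≡ Triple.a t ⊎ x ≡ Triple.b t ⊎ x ≡ Triple.c t))

data Tree : Set where
  leaf : Label → Tree
  node : List Tree → Tree

mutual
  leaves : Tree → List Label
  leaves (leaf x)  = x ∷ []
  leaves (node ts) = leavesF ts

  leavesF : List Tree → List Label
  leavesF []       = []
  leavesF (t ∷ ts) = leaves t ++ leavesF ts

-- Every inner vertex has at least two children (non-root inner vertices
-- have degree ≥ 3; the root, being an inner and not a leaf (degree ≠ 1)
-- vertex, has degree ≥ 2).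
data WellBranched : Tree → Set where
  leaf : ∀ x → WellBranched (leaf x)
  node : ∀ {ts} → 2 ≤ length ts → All WellBranched ts → WellBranched (node ts)

record IsRootedTree (T : Tree) : Set where
  field
    rootInner    : ∃[ ts ] (T ≡ node ts)
    branching    : WellBranched T
    leavesUnique : Unique (leaves T)

-- v ≺ T : v is a vertex of T other than the root ρ_T (a proper descendant).
data _≺_ : Tree → Tree → Set where
  child  : ∀ {v ts}   → v ∈ ts → v ≺ node ts
  deeper : ∀ {v w ts} → v ≺ w → w ∈ ts → v ≺ node ts

-- T displays ab|c: a, b, c are leaves of T and the path from a to b does
-- not meet the path from c to the root; i.e. the last common ancestor
-- of a and b is a non-root vertex v whose cluster contains a, b but not c.
Displays : Tree → Triple → Set
Displays T t =
  (Triple.a t ∈ leaves T × Triple.b t ∈ leaves T × Triple.c t ∈ leaves T)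
  × ∃[ v ] (v ≺ T × Triple.a t ∈ leaves v × Triple.b t ∈ leaves v × Triple.c t ∉ leaves v)

DisplaysAll : Tree → TripleSet → Set
DisplaysAll T R = ∀ {t} → t ∈ R → Displays T t

Consistent : TripleSet → Set
Consistent R = ∃[ T ] (IsRootedTree T × DisplaysAll T R)

InSpan : TripleSet → Tree → Set
InSpan R T = IsRootedTree T × (∀ x → (x ∈ leaves T ⇔ x ∈L R)) × DisplaysAll T R

InCl : TripleSet → Triple → Set
InCl R t = ∀ T → InSpan R T → Displays T t

Representative : TripleSet → TripleSet → Set
Representative R R' = Unique R' × R' ⊆ R × (∀ t → (InCl R' t ⇔ InCl R t))

InclMinimal : TripleSet → TripleSet → Set
InclMinimal R R' =
  Representative R R' × (∀ R'' → Representative R R'' → R'' ⊆ R' → R' ⊆ R'')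

MinCard : TripleSet → TripleSet → Set
MinCard R R' =
  Representative R R' × (∀ R'' → Representative R R'' → length R' ≤ length R'')

module Submission where

-- Representative subsets behave like the bases of a matroid. If A is inclusion-minimal, B is
-- representative and x = ab|c ∈ A ∖ B, then some y ∈ B can replace x: (A ∖ {x}) ∪ {y} is again
-- representative. The usual basis-exchange induction then gives every inclusion-minimal
-- representative subset the size of a smallest one.
--
-- Exchange rests on a description of the closure through Aho graphs [S, Y] (vertices Y, an edge
-- a'b' for every a'b'|c' ∈ S with a', b', c' ∈ Y): x ∈ cl(S) iff for some Y ⊆ L_R the vertices a and b
-- are connected and every vertex is connected to a, b or c. Such a Y for (A ∖ {x}) ∪ B extends to
-- one on which every vertex is already connected to a, b or c in [A, Y]. By minimality a and b are
-- disconnected in [A ∖ {x}, Y], so the path joining them in [(A ∖ {x}) ∪ B, Y] has an edge leaving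
-- the component of a. It comes from a triple y ∈ B and leads into the component of b.

open import Defs hiding (_⊆_)
open import Data.Bool using (T; not)
open import Data.Bool.Properties using (T-irrelevant; T-not-≡)
open import Data.Empty using (⊥; ⊥-elim)
open import Data.List using (List; []; _∷_; length; _++_; filter; concatMap; deduplicate)
open import Data.List.Membership.Propositional using (_∈_; _∉_; find; lose)
open import Data.List.Membership.Propositional.Properties
  using (∈-filter⁺; ∈-filter⁻; ∈-++⁺ˡ; ∈-++⁺ʳ; ∈-++⁻; ∈-concatMap⁺; ∈-concatMap⁻; ∈-deduplicate⁺; ∈-deduplicate⁻)
open import Data.List.Properties using (filter-notAll)
open import Data.List.Relation.Binary.Subset.Propositional using (_⊆_)
open import Data.List.Relation.Unary.Any using (Any; here; there; any?)
import Data.List.Relation.Unary.Any as Any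
open import Data.List.Relation.Unary.AllPairs using ([]; _∷_)
open import Data.List.Relation.Unary.All using ([]; _∷_)
import Data.List.Relation.Unary.All as All
import Data.List.Relation.Unary.All.Properties as All
open import Data.List.Relation.Unary.Unique.Propositional using (Unique)
import Data.List.Relation.Unary.Unique.Propositional.Properties as Unique
open import Data.List.Relation.Unary.Unique.Propositional.Properties using (Unique[x∷xs]⇒x∉xs)
open import Data.Nat using (_≤_; _<_; _≤?_; _≡ᵇ_; z≤n; s≤s)
open import Data.Nat.Induction using (<-wellFounded)
open import Data.Nat.Properties using (_≟_; <⇒≢; <ᵇ⇒<; <⇒<ᵇ; ≡⇒≡ᵇ; <-cmp; ≤-trans; ≤-<-trans; <⇒≱)
open import Data.Product using (_×_; _,_; proj₁; proj₂; ∃-syntax)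
open import Data.Sum using (_⊎_; inj₁; inj₂)
open import Function using (_∘_; _⇔_; mk⇔; Equivalence)
open import Function.Properties.Equivalence using (⇔-isEquivalence)
open import Function.Construct.Composition using (_⇔-∘_)
open import Function.Construct.Symmetry using (⇔-sym)
open import Induction.WellFounded using (Acc; acc)
open import Relation.Binary.Core using (_=[_]⇒_)
open import Relation.Binary.Definitions using (DecidableEquality; tri<; tri≈; tri>)
open import Relation.Binary.Construct.Closure.Equivalence using (EqClosure)
import Relation.Binary.Construct.Closure.Equivalence as EqClosure
open import Relation.Binary.Construct.Closure.ReflexiveTransitive using (ε; _◅_)
open import Relation.Binary.Construct.Closure.Symmetric using (SymClosure; fwd; bwd)
open import Relation.Binary.PropositionalEquality using (_≡_; _≢_; refl; sym; trans; subst; ≢-sym)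
open import Relation.Nullary using (¬_; Dec; yes; no)
open import Relation.Nullary.Decidable using (map′; _×-dec_; dec-false; decidable-stable; ¬¬-excluded-middle)

open Triple using (a; b; c)

-- Classical reasoning

-- A record rather than ¬ ¬ A itself: a function type as monad carrier keeps Agda from
-- propagating the expected type into do-blocks.
record Classically (A : Set) : Set where
  constructor classically
  field run : ¬ ¬ A

pure : ∀ {A} → A → Classically A
pure x = classically λ k → k x

_>>=_ : ∀ {A B} → Classically A → (A → Classically B) → Classically B
m >>= f = classically λ k → Classically.run m λ x → Classically.run (f x) k

excluded-middle : ∀ {A} → Classically (Dec A)
excluded-middle = classically ¬¬-excluded-middle

classically-stable : ∀ {A} → Dec A → Classically A → A
classically-stable A? m = decidable-stable A? (Classically.run m)

comprehension : ∀ {A : Set} (P : A → Set) (Y : List A) →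
              Classically (∃[ W ] ((∀ {y} → y ∈ W → P y) × (∀ {y} → y ∈ Y → P y → y ∈ W)))
comprehension P [] = pure ([] , (λ ()) , λ ())
comprehension P (y ∷ Y) = do
  W , W⊆P , Y∩P⊆W ← comprehension P Y
  yes Py ← excluded-middle {A = P y}
    where no ¬Py → pure (W , W⊆P , λ { (here refl) Py → ⊥-elim (¬Py Py) ; (there m) → Y∩P⊆W m })
  pure (y ∷ W , (λ { (here refl) → Py ; (there m) → W⊆P m })
               , λ { (here refl) _ → here refl ; (there m) Pz → there (Y∩P⊆W m Pz) })

crossing-edge : ∀ {A : Set} {E : A → A → Set} {P : A → Set} {u v} → EqClosure E u v → P u → ¬ P v →
           Classically (∃[ d ] ∃[ e ] (SymClosure E d e × P d × ¬ P e))
crossing-edge ε Pu ¬Pv = ⊥-elim (¬Pv Pu)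
crossing-edge {P = P} (_◅_ {j = w} step path) Pu ¬Pv = do
  yes Pw ← excluded-middle {A = P w}
    where no ¬Pw → pure (_ , _ , step , Pu , ¬Pw)
  crossing-edge path Pw ¬Pv

module ListOps {A : Set} (_≟_ : DecidableEquality A) where

  open import Data.List.Membership.DecPropositional _≟_ using (_∈?_; _∉?_)

  -- Opaque: on concrete lists filter would compute, and the implicit arguments of the lemmas
  -- below could no longer be inferred.
  opaque
    _∩_ : List A → List A → List A
    X ∩ W = filter (_∈? W) X

    _∖_ : List A → List A → List A
    X ∖ W = filter (_∉? W) X

    remove : A → List A → List A
    remove x X = X ∖ (x ∷ [])

    ∈-∩⁺ : ∀ {X W y} → y ∈ X → y ∈ W → y ∈ X ∩ W
    ∈-∩⁺ = ∈-filter⁺ (_∈? _)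

    ∈-∩⁻ : ∀ {X W y} → y ∈ X ∩ W → y ∈ X × y ∈ W
    ∈-∩⁻ = ∈-filter⁻ (_∈? _)

    ∈-∖⁺ : ∀ {X W y} → y ∈ X → y ∉ W → y ∈ X ∖ W
    ∈-∖⁺ = ∈-filter⁺ (_∉? _)

    ∈-∖⁻ : ∀ {X W y} → y ∈ X ∖ W → y ∈ X × y ∉ W
    ∈-∖⁻ = ∈-filter⁻ (_∉? _)

    ∈-remove⁺ : ∀ {X x y} → y ∈ X → y ≢ x → y ∈ remove x X
    ∈-remove⁺ y∈X y≢x = ∈-∖⁺ y∈X λ { (here y≡x) → y≢x y≡x }

    ∈-remove⁻ : ∀ {X x y} → y ∈ remove x X → y ∈ X × y ≢ x
    ∈-remove⁻ m = let y∈X , y∉[x] = ∈-∖⁻ m in y∈X , y∉[x] ∘ here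

    ∩-unique : ∀ {X W} → Unique X → Unique (X ∩ W)
    ∩-unique = Unique.filter⁺ (_∈? _)

    ∖-unique : ∀ {X W} → Unique X → Unique (X ∖ W)
    ∖-unique = Unique.filter⁺ (_∉? _)

    length-∩ : ∀ {X W y} → y ∈ X → y ∉ W → length (X ∩ W) < length X
    length-∩ {X} y∈X y∉W = filter-notAll (_∈? _) X (lose y∈X y∉W)

    length-∖ : ∀ {X W y} → y ∈ X → y ∈ W → length (X ∖ W) < length X
    length-∖ {X} y∈X y∈W = filter-notAll (_∉? _) X (lose y∈X (λ y∉W → y∉W y∈W))

    remove-unique : ∀ {X x} → Unique X → Unique (remove x X)
    remove-unique = ∖-unique

    length-remove : ∀ {X x} → x ∈ X → length (remove x X) < length X
    length-remove x∈X = length-∖ x∈X (here refl)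

  unique-⊆⇒length-≤ : ∀ {X Y} → Unique X → X ⊆ Y → length X ≤ length Y
  unique-⊆⇒length-≤ {[]} _ _ = z≤n
  unique-⊆⇒length-≤ {x ∷ X} u@(_ ∷ uX) X⊆Y =
    ≤-<-trans (unique-⊆⇒length-≤ uX (λ m → ∈-remove⁺ (X⊆Y (there m)) λ { refl → Unique[x∷xs]⇒x∉xs u m }))
              (length-remove (X⊆Y (here refl)))

  unique-⊆⇒length-< : ∀ {X Y y} → Unique X → X ⊆ Y → y ∈ Y → y ∉ X → length X < length Y
  unique-⊆⇒length-< uX X⊆Y y∈Y y∉X =
    ≤-<-trans (unique-⊆⇒length-≤ uX (λ m → ∈-remove⁺ (X⊆Y m) λ { refl → y∉X m })) (length-remove y∈Y)

  ⊈⇒∃∉ : ∀ {X Y} → ¬ X ⊆ Y → ∃[ x ] (x ∈ X × x ∉ Y)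
  ⊈⇒∃∉ {X} {Y} X⊈Y with any? (_∉? Y) X
  ... | yes some = find some
  ... | no none  = ⊥-elim (X⊈Y λ x∈X → decidable-stable (_ ∈? Y) (none ∘ lose x∈X))

  ⊆-stable : ∀ {X Y} → ¬ ¬ (X ⊆ Y) → X ⊆ Y
  ⊆-stable {Y = Y} ¬¬X⊆Y x∈X = decidable-stable (_ ∈? Y) λ x∉Y → ¬¬X⊆Y λ X⊆Y → x∉Y (X⊆Y x∈X)

unique-++⁻ˡ : ∀ {A : Set} (xs : List A) {ys} → Unique (xs ++ ys) → Unique xs
unique-++⁻ˡ []       _         = []
unique-++⁻ˡ (_ ∷ xs) (x∉ ∷ u) = All.++⁻ˡ xs x∉ ∷ unique-++⁻ˡ xs u

unique-++⁻ʳ : ∀ {A : Set} (xs : List A) {ys} → Unique (xs ++ ys) → Unique ys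
unique-++⁻ʳ []       u        = u
unique-++⁻ʳ (_ ∷ xs) (_ ∷ u) = unique-++⁻ʳ xs u

unique-++-disjoint : ∀ {A : Set} (xs : List A) {ys x} → Unique (xs ++ ys) → x ∈ xs → x ∈ ys → ⊥
unique-++-disjoint (_ ∷ xs) (x∉ ∷ _) (here refl) x∈ys = All.lookup x∉ (∈-++⁺ʳ xs x∈ys) refl
unique-++-disjoint (_ ∷ xs) (_ ∷ u)  (there x∈)  x∈ys = unique-++-disjoint xs u x∈ x∈ys

-- Basis exchange

module BasisExchange {A : Set} (_≟_ : DecidableEquality A)
                     (Rep : List A → Set) (Rep⇒Unique : ∀ {X} → Rep X → Unique X) where

  open ListOps _≟_
  open import Data.List.Membership.DecPropositional _≟_ using (_∈?_; _∉?_)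

  Minimal : List A → Set
  Minimal X = Rep X × (∀ Y → Rep Y → Y ⊆ X → X ⊆ Y)

  Minimum : List A → Set
  Minimum X = Rep X × (∀ Y → Rep Y → length X ≤ length Y)

  ExchangeProperty : Set
  ExchangeProperty = ∀ {X Y x} → Rep X → ¬ Rep (remove x X) → Rep Y → x ∈ X → x ∉ Y →
                     Classically (∃[ y ] (y ∈ Y × Rep (y ∷ remove x X)))

  minimal⇒essential : ∀ {X x} → Minimal X → x ∈ X → ¬ Rep (remove x X)
  minimal⇒essential (_ , minimal) x∈X rep =
    proj₂ (∈-remove⁻ (minimal _ rep (λ m → proj₁ (∈-remove⁻ m)) x∈X)) refl

  minimal-⊆ : ∀ {X} → Rep X → Classically (∃[ X′ ] (Minimal X′ × X′ ⊆ X))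
  minimal-⊆ = go (<-wellFounded _)
    where
    go : ∀ {X} → Acc _<_ (length X) → Rep X → Classically (∃[ X′ ] (Minimal X′ × X′ ⊆ X))
    go {X} (acc rs) repX = do
      yes (Y , repY , Y⊆X , X⊈Y) ← excluded-middle {A = ∃[ Y ] (Rep Y × Y ⊆ X × ¬ X ⊆ Y)}
        where no none → pure (X , (repX , λ Y repY Y⊆X → ⊆-stable λ X⊈Y → none (Y , repY , Y⊆X , X⊈Y)) , λ m → m)
      let x , x∈X , x∉Y = ⊈⇒∃∉ X⊈Y
      X′ , minX′ , X′⊆Y ← go (rs (unique-⊆⇒length-< (Rep⇒Unique repY) Y⊆X x∈X x∉Y)) repY
      pure (X′ , minX′ , λ m → Y⊆X (X′⊆Y m))

  module _ (exchange : ExchangeProperty) where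

    -- Induction on |X ∖ Y|: trade some x ∈ X ∖ Y for an element of Y, then shrink to a minimal set.
    minimal-length-≥ : ∀ {X Y} → Minimal X → Minimal Y → Classically (length Y ≤ length X)
    minimal-length-≥ {Y = Y} minX (repY , minimalY) = go (<-wellFounded _) minX
      where
      go : ∀ {X} → Acc _<_ (length (X ∖ Y)) → Minimal X → Classically (length Y ≤ length X)
      go {X} (acc rs) minX@(repX , _) with any? (_∉? Y) X
      ... | no none = pure (unique-⊆⇒length-≤ (Rep⇒Unique repY)
                             (minimalY X repX λ x∈X → decidable-stable (_ ∈? Y) (none ∘ lose x∈X)))
      ... | yes some with find some
      ... | x , x∈X , x∉Y = do
        y , y∈Y , rep₁ ← exchange repX (minimal⇒essential minX x∈X) repY x∈X x∉Y
        X₂ , minX₂ , X₂⊆ ← minimal-⊆ rep₁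
        let uX₂ = Rep⇒Unique (proj₁ minX₂)
        Y≤X₂ ← go (rs (fewer-outside uX₂ y∈Y X₂⊆)) minX₂
        pure (≤-trans Y≤X₂ (≤-trans (unique-⊆⇒length-≤ uX₂ X₂⊆) (length-remove x∈X)))
        where
        fewer-outside : ∀ {X₂ y} → Unique X₂ → y ∈ Y → X₂ ⊆ y ∷ remove x X → length (X₂ ∖ Y) < length (X ∖ Y)
        fewer-outside {X₂} {y} uX₂ y∈Y X₂⊆ = unique-⊆⇒length-< (∖-unique uX₂) kept (∈-∖⁺ x∈X x∉Y) dropped
          where
          kept : X₂ ∖ Y ⊆ X ∖ Y
          kept m with ∈-∖⁻ m
          ... | z∈X₂ , z∉Y with X₂⊆ z∈X₂
          ...   | here refl = ⊥-elim (z∉Y y∈Y)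
          ...   | there z∈  = ∈-∖⁺ (proj₁ (∈-remove⁻ z∈)) z∉Y
          dropped : x ∉ X₂ ∖ Y
          dropped m with X₂⊆ (proj₁ (∈-∖⁻ m))
          ... | here refl = x∉Y y∈Y
          ... | there x∈  = proj₂ (∈-remove⁻ x∈) refl

    minimal⇔minimum : ∀ {X} → Minimal X ⇔ Minimum X
    minimal⇔minimum {X} = mk⇔ minimal⇒minimum minimum⇒minimal
      where
      minimal⇒minimum : Minimal X → Minimum X
      minimal⇒minimum minX@(repX , _) = repX , λ Y repY → classically-stable (length X ≤? length Y) do
        Y′ , minY′ , Y′⊆Y ← minimal-⊆ repY
        X≤Y′ ← minimal-length-≥ minY′ minX
        pure (≤-trans X≤Y′ (unique-⊆⇒length-≤ (Rep⇒Unique (proj₁ minY′)) Y′⊆Y))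
      minimum⇒minimal : Minimum X → Minimal X
      minimum⇒minimal (repX , least) = repX , λ Y repY Y⊆X x∈X → decidable-stable (_ ∈? Y) λ x∉Y →
        <⇒≱ (unique-⊆⇒length-< (Rep⇒Unique repY) Y⊆X x∈X x∉Y) (least Y repY)

-- Triples and leaf sets

-- Opaque so that unification recovers x from leavesOf x.
opaque
  leavesOf : Triple → List Label
  leavesOf x = a x ∷ b x ∷ c x ∷ []

  leavesOf-all : ∀ {x} {P : Label → Set} → P (a x) → P (b x) → P (c x) → ∀ {y} → y ∈ leavesOf x → P y
  leavesOf-all Pa _  _  (here refl)                 = Pa
  leavesOf-all _  Pb _  (there (here refl))         = Pb
  leavesOf-all _  _  Pc (there (there (here refl))) = Pc

  ∈-leavesOf⁺ : ∀ {x y} → y ≡ a x ⊎ y ≡ b x ⊎ y ≡ c x → y ∈ leavesOf x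
  ∈-leavesOf⁺ (inj₁ y≡a)        = here y≡a
  ∈-leavesOf⁺ (inj₂ (inj₁ y≡b)) = there (here y≡b)
  ∈-leavesOf⁺ (inj₂ (inj₂ y≡c)) = there (there (here y≡c))

  ∈-leavesOf⁻ : ∀ {x y} → y ∈ leavesOf x → y ≡ a x ⊎ y ≡ b x ⊎ y ≡ c x
  ∈-leavesOf⁻ (here y≡a)                 = inj₁ y≡a
  ∈-leavesOf⁻ (there (here y≡b))         = inj₂ (inj₁ y≡b)
  ∈-leavesOf⁻ (there (there (here y≡c))) = inj₂ (inj₂ y≡c)

  a∈ : ∀ {x Z} → leavesOf x ⊆ Z → a x ∈ Z
  a∈ x⊆Z = x⊆Z (here refl)

  b∈ : ∀ {x Z} → leavesOf x ⊆ Z → b x ∈ Z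
  b∈ x⊆Z = x⊆Z (there (here refl))

  c∈ : ∀ {x Z} → leavesOf x ⊆ Z → c x ∈ Z
  c∈ x⊆Z = x⊆Z (there (there (here refl)))

≢ᵇ⇒≢ : ∀ {m n} → T (not (m ≡ᵇ n)) → m ≢ n
≢ᵇ⇒≢ {m} m≢ᵇm refl = subst T (Equivalence.to T-not-≡ m≢ᵇm) (≡⇒≡ᵇ m m refl)

≢⇒≢ᵇ : ∀ {m n} → m ≢ n → T (not (m ≡ᵇ n))
≢⇒≢ᵇ {m} {n} m≢n = Equivalence.from T-not-≡ (dec-false (m ≟ n) m≢n)

a≢b : ∀ x → a x ≢ b x
a≢b x = <⇒≢ (<ᵇ⇒< (a x) (b x) (Triple.a<b x))

c≢a : ∀ x → c x ≢ a x
c≢a x = ≢ᵇ⇒≢ (Triple.c≢a x)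

c≢b : ∀ x → c x ≢ b x
c≢b x = ≢ᵇ⇒≢ (Triple.c≢b x)

triple-≡ : ∀ {s t} → a s ≡ a t → b s ≡ b t → c s ≡ c t → s ≡ t
triple-≡ {triple _ _ _ p q r} {triple _ _ _ p′ q′ r′} refl refl refl
  with refl ← T-irrelevant p p′ | refl ← T-irrelevant q q′ | refl ← T-irrelevant r r′ = refl

_≟ₜ_ : DecidableEquality Triple
s ≟ₜ t = map′ (λ (eqa , eqb , eqc) → triple-≡ eqa eqb eqc) (λ { refl → refl , refl , refl })
              (a s ≟ a t ×-dec b s ≟ b t ×-dec c s ≟ c t)

-- The triple ac|b.
regroup : ∀ x → ∃[ y ] (a x ∷ c x ∷ [] ⊆ a y ∷ b y ∷ [] × c y ≡ b x)
regroup x with <-cmp (a x) (c x)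
... | tri< a<c _ _ = triple (a x) (c x) (b x) (<⇒<ᵇ a<c) (≢⇒≢ᵇ (≢-sym (a≢b x))) (≢⇒≢ᵇ (≢-sym (c≢b x)))
                   , (λ { (here refl) → here refl ; (there (here refl)) → there (here refl) }) , refl
... | tri≈ _ a≡c _ = ⊥-elim (c≢a x (sym a≡c))
... | tri> _ _ c<a = triple (c x) (a x) (b x) (<⇒<ᵇ c<a) (≢⇒≢ᵇ (≢-sym (c≢b x))) (≢⇒≢ᵇ (≢-sym (a≢b x)))
                   , (λ { (here refl) → there (here refl) ; (there (here refl)) → here refl }) , refl

open ListOps _≟_ using (_∩_; _∖_; ∈-∩⁺; ∈-∩⁻; ∈-∖⁺; ∈-∖⁻; ∩-unique; ∖-unique; length-∩; length-∖; ⊈⇒∃∉)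
open import Data.List.Membership.DecPropositional _≟_ using (_∈?_; _∉?_)
open import Data.List.Relation.Binary.Subset.DecPropositional _≟_ using (_⊆?_)
open import Data.List.Relation.Unary.Unique.DecPropositional.Properties _≟_ using (deduplicate-!)

opaque
  labels : TripleSet → List Label
  labels S = deduplicate _≟_ (concatMap leavesOf S)

  labels-unique : ∀ S → Unique (labels S)
  labels-unique S = deduplicate-! (concatMap leavesOf S)

  ∈-labels⁺ : ∀ {S t} → t ∈ S → leavesOf t ⊆ labels S
  ∈-labels⁺ t∈S y∈t = ∈-deduplicate⁺ _≟_ (∈-concatMap⁺ leavesOf (lose t∈S y∈t))

  ∈-labels⁻ : ∀ {S y} → y ∈ labels S → ∃[ t ] (t ∈ S × y ∈ leavesOf t)
  ∈-labels⁻ {S} m = find (∈-concatMap⁻ leavesOf (∈-deduplicate⁻ _≟_ (concatMap leavesOf S) m))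

∈L⇔∈labels : ∀ {y S} → y ∈L S ⇔ y ∈ labels S
∈L⇔∈labels = mk⇔ (λ (_ , t∈S , y∈t) → ∈-labels⁺ t∈S (∈-leavesOf⁺ y∈t))
                 (λ m → let t , t∈S , y∈t = ∈-labels⁻ m in t , t∈S , ∈-leavesOf⁻ y∈t)

labels-mono : ∀ {S S′} → S ⊆ S′ → labels S ⊆ labels S′
labels-mono S⊆S′ m = let _ , t∈S , y∈t = ∈-labels⁻ m in ∈-labels⁺ (S⊆S′ t∈S) y∈t

-- Trees

∈-leavesF⁺ : ∀ {ts t x} → t ∈ ts → x ∈ leaves t → x ∈ leavesF ts
∈-leavesF⁺ {t ∷ _}  (here refl) x∈t = ∈-++⁺ˡ x∈t
∈-leavesF⁺ {t ∷ _}  (there t∈)  x∈t = ∈-++⁺ʳ (leaves t) (∈-leavesF⁺ t∈ x∈t)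

≺-leaves : ∀ {v T} → v ≺ T → leaves v ⊆ leaves T
≺-leaves (child v∈)    x∈v = ∈-leavesF⁺ v∈ x∈v
≺-leaves (deeper v≺ w∈) x∈v = ∈-leavesF⁺ w∈ (≺-leaves v≺ x∈v)

≺-child : ∀ {w ts} → w ≺ node ts → ∃[ t ] (t ∈ ts × leaves w ⊆ leaves t)
≺-child (child w∈)     = _ , w∈ , λ m → m
≺-child (deeper w≺ u∈) = _ , u∈ , ≺-leaves w≺

child-unique : ∀ {ts t} → Unique (leavesF ts) → t ∈ ts → Unique (leaves t)
child-unique {t ∷ _} u (here refl) = unique-++⁻ˡ (leaves t) u
child-unique {t ∷ _} u (there t∈)  = child-unique (unique-++⁻ʳ (leaves t) u) t∈

same-child : ∀ {ts t t′ x} → Unique (leavesF ts) → t ∈ ts → t′ ∈ ts → x ∈ leaves t → x ∈ leaves t′ → t ≡ t′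
same-child {t ∷ _} u (here refl) (here refl) _   _    = refl
same-child {t ∷ _} u (here refl) (there t′∈) x∈t x∈t′ =
  ⊥-elim (unique-++-disjoint (leaves t) u x∈t (∈-leavesF⁺ t′∈ x∈t′))
same-child {t ∷ _} u (there t∈)  (here refl) x∈t x∈t′ =
  ⊥-elim (unique-++-disjoint (leaves t) u x∈t′ (∈-leavesF⁺ t∈ x∈t))
same-child {t ∷ _} u (there t∈)  (there t′∈) x∈t x∈t′ = same-child (unique-++⁻ʳ (leaves t) u) t∈ t′∈ x∈t x∈t′

-- Clusters of a tree with distinct leaf labels are nested or disjoint.
≺-below : ∀ {T v w x y} → Unique (leaves T) → v ≺ T → x ∈ leaves v → y ∈ leaves v →
          w ≺ T → x ∈ leaves w → y ∉ leaves w → w ≺ v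
≺-below uniq (child v∈) x∈v y∈v (child w∈) x∈w y∉w
  with refl ← same-child uniq v∈ w∈ x∈v x∈w = ⊥-elim (y∉w y∈v)
≺-below uniq (child v∈) x∈v y∈v (deeper w≺ u∈) x∈w y∉w
  with refl ← same-child uniq v∈ u∈ x∈v (≺-leaves w≺ x∈w) = w≺
≺-below uniq (deeper v≺ t∈) x∈v y∈v (child w∈) x∈w y∉w
  with refl ← same-child uniq t∈ w∈ (≺-leaves v≺ x∈v) x∈w = ⊥-elim (y∉w (≺-leaves v≺ y∈v))
≺-below uniq (deeper v≺ t∈) x∈v y∈v (deeper w≺ u∈) x∈w y∉w
  with refl ← same-child uniq t∈ u∈ (≺-leaves v≺ x∈v) (≺-leaves w≺ x∈w) =
  ≺-below (child-unique uniq t∈) v≺ x∈v y∈v w≺ x∈w y∉w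

_⪯_ : Tree → Tree → Set
v ⪯ T = v ≡ T ⊎ v ≺ T

⪯-below : ∀ {T v w x y} → Unique (leaves T) → v ⪯ T → x ∈ leaves v → y ∈ leaves v →
          w ≺ T → x ∈ leaves w → y ∉ leaves w → w ≺ v
⪯-below _    (inj₁ refl) _ _ w≺ _ _ = w≺
⪯-below uniq (inj₂ v≺)   = ≺-below uniq v≺

⪯-child : ∀ {v t ts} → v ⪯ t → t ∈ ts → v ≺ node ts
⪯-child (inj₁ refl) t∈ = child t∈
⪯-child (inj₂ v≺t)  t∈ = deeper v≺t t∈

wellBranched-leaf : ∀ {T} → WellBranched T → ∃[ x ] (x ∈ leaves T)
wellBranched-leaf (leaf x) = x , here refl
wellBranched-leaf (node {t ∷ _} _ (wb ∷ _)) = let x , x∈t = wellBranched-leaf wb in x , ∈-++⁺ˡ x∈t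

two-leaves⇒node : ∀ {T x y} → x ∈ leaves T → y ∈ leaves T → x ≢ y → ∃[ ts ] (T ≡ node ts)
two-leaves⇒node {leaf _}  (here refl) (here refl) x≢y = ⊥-elim (x≢y refl)
two-leaves⇒node {node ts} _ _ _ = ts , refl

HasSeparatingCluster : Tree → Triple → Set
HasSeparatingCluster T t = ∃[ v ] (v ≺ T × a t ∈ leaves v × b t ∈ leaves v × c t ∉ leaves v)

ResolvesOn : Tree → TripleSet → List Label → Set
ResolvesOn T S Y = ∀ {t} → t ∈ S → leavesOf t ⊆ Y → HasSeparatingCluster T t

displaysAll⇒resolvesOn : ∀ {T S Y} → DisplaysAll T S → ResolvesOn T S Y
displaysAll⇒resolvesOn disp t∈S _ = proj₂ (disp t∈S)

separating-below : ∀ {T v t} → Unique (leaves T) → v ⪯ T → leavesOf t ⊆ leaves v →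
                   HasSeparatingCluster T t → HasSeparatingCluster v t
separating-below uniq v⪯T t⊆v (w , w≺ , a∈w , b∈w , c∉w) =
  w , ⪯-below uniq v⪯T (a∈ t⊆v) (c∈ t⊆v) w≺ a∈w c∉w , a∈w , b∈w , c∉w

resolvesOn-below : ∀ {T v S Y} → Unique (leaves T) → v ⪯ T → Y ⊆ leaves v → ResolvesOn T S Y → ResolvesOn v S Y
resolvesOn-below uniq v⪯T Y⊆v res {t} t∈S t⊆Y =
  separating-below {t = t} uniq v⪯T (λ m → Y⊆v (t⊆Y m)) (res t∈S t⊆Y)

separating-conflict : ∀ {T x y} → Unique (leaves T) → a x ∷ c x ∷ [] ⊆ a y ∷ b y ∷ [] → c y ≡ b x →
                      HasSeparatingCluster T x → HasSeparatingCluster T y → ⊥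
separating-conflict {x = x} uniq ac⊆ cy≡bx (v , v≺ , ax∈v , bx∈v , cx∉v) (w , w≺ , ay∈w , by∈w , cy∉w) =
  subst (_∉ leaves w) cy≡bx cy∉w (≺-leaves v≺w bx∈v)
  where
  in-w : a x ∷ c x ∷ [] ⊆ leaves w
  in-w m with ac⊆ m
  ... | here refl         = ay∈w
  ... | there (here refl) = by∈w

  v≺w : v ≺ w
  v≺w = ≺-below uniq w≺ (in-w (here refl)) (in-w (there (here refl))) v≺ ax∈v cx∉v

-- The Aho graph

data AhoEdge (S : TripleSet) (Y : List Label) : Label → Label → Set where
  edge : ∀ {t} → t ∈ S → leavesOf t ⊆ Y → AhoEdge S Y (a t) (b t)

Connected : TripleSet → List Label → Label → Label → Set
Connected S Y = EqClosure (AhoEdge S Y)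

EdgeClosed : (Label → Set) → TripleSet → List Label → Set
EdgeClosed P S Y = AhoEdge S Y =[ P ]⇒ _⇔_

connected-closed : ∀ {P S Y u v} → EdgeClosed P S Y → Connected S Y u v → P u → P v
connected-closed {P} closed u~v = Equivalence.to (EqClosure.gfold ⇔-isEquivalence P closed u~v)

connected-refl : ∀ {S Y u} → Connected S Y u u
connected-refl = EqClosure.reflexive _

connected-sym : ∀ {S Y u v} → Connected S Y u v → Connected S Y v u
connected-sym = EqClosure.symmetric _

connected-trans : ∀ {S Y u v w} → Connected S Y u v → Connected S Y v w → Connected S Y u w
connected-trans = EqClosure.transitive _

connected-mono : ∀ {S S′ Y Y′ u v} → S ⊆ S′ → Y ⊆ Y′ → Connected S Y u v → Connected S′ Y′ u v
connected-mono S⊆ Y⊆ = EqClosure.map λ { (edge t∈S t⊆Y) → edge (S⊆ t∈S) (λ m → Y⊆ (t⊆Y m)) }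

connectedTo-closed : ∀ {S Y z} → EdgeClosed (λ y → Connected S Y y z) S Y
connectedTo-closed e = mk⇔ (connected-trans (connected-sym (EqClosure.return e)))
                           (connected-trans (EqClosure.return e))

Reaches : TripleSet → List Label → List Label → Label → Set
Reaches S Y L y = Any (Connected S Y y) L

reaches-closed : ∀ {S Y L} → EdgeClosed (Reaches S Y L) S Y
reaches-closed e = mk⇔ (Any.map (Equivalence.to (connectedTo-closed e)))
                       (Any.map (Equivalence.from (connectedTo-closed e)))

reaches-closure : ∀ {P S Y L y} → EdgeClosed P S Y → (∀ {z} → z ∈ L → P z) → Reaches S Y L y → P y
reaches-closure closed L⊆P reaches =
  let _ , z∈L , y~z = find reaches in connected-closed closed (connected-sym y~z) (L⊆P z∈L)

Anchored : TripleSet → List Label → Triple → Set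
Anchored S Y x = ∀ {y} → y ∈ Y → Reaches S Y (leavesOf x) y

Witness : TripleSet → List Label → Triple → Set
Witness S Y x = leavesOf x ⊆ Y × Connected S Y (a x) (b x) × Anchored S Y x

connected-endpoint : ∀ {S Y u v} → Connected S Y u v → u ≢ v → u ∈ labels S
connected-endpoint ε                       u≢u = ⊥-elim (u≢u refl)
connected-endpoint (fwd (edge t∈S _) ◅ _) _   = a∈ (∈-labels⁺ t∈S)
connected-endpoint (bwd (edge t∈S _) ◅ _) _   = b∈ (∈-labels⁺ t∈S)

edge-source : ∀ {S Y d e} → SymClosure (AhoEdge S Y) d e →
              ∃[ t ] (t ∈ S × SymClosure (AhoEdge (t ∷ []) Y) d e)
edge-source (fwd (edge t∈S t⊆Y)) = _ , t∈S , fwd (edge (here refl) t⊆Y)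
edge-source (bwd (edge t∈S t⊆Y)) = _ , t∈S , bwd (edge (here refl) t⊆Y)

edge-target-∈ : ∀ {S Y d e} → SymClosure (AhoEdge S Y) d e → e ∈ Y
edge-target-∈ (fwd (edge _ t⊆Y)) = b∈ t⊆Y
edge-target-∈ (bwd (edge _ t⊆Y)) = a∈ t⊆Y

edge-connected : ∀ {S Y t d e} → t ∈ S → SymClosure (AhoEdge (t ∷ []) Y) d e → Connected S Y d e
edge-connected t∈S d–e = connected-mono (λ { (here refl) → t∈S }) (λ m → m) (d–e ◅ ε)

closed-transfer : ∀ {P Q S Y} → EdgeClosed P S Y → (∀ {y} → y ∈ Y → P y → Q y) → (∀ {y} → Q y → P y) →
                  EdgeClosed Q S Y
closed-transfer closed P⇒Q Q⇒P (edge t∈S t⊆Y) =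
  mk⇔ (λ Qa → P⇒Q (b∈ t⊆Y) (Equivalence.to   (closed (edge t∈S t⊆Y)) (Q⇒P Qa)))
      (λ Qb → P⇒Q (a∈ t⊆Y) (Equivalence.from (closed (edge t∈S t⊆Y)) (Q⇒P Qb)))

closed-part : ∀ {P S Y} → EdgeClosed P S Y →
              Classically (∃[ W ] (EdgeClosed (_∈ W) S Y × (∀ {y} → y ∈ W → P y) ×
                                   (∀ {y} → y ∈ Y → P y → y ∈ W)))
closed-part {P} {S} {Y} closed = do
  W , W⊆P , Y∩P⊆W ← comprehension P Y
  pure (W , closed-transfer closed Y∩P⊆W W⊆P , W⊆P , Y∩P⊆W)

child-closed : ∀ {ts t S Y} → Unique (leavesF ts) → t ∈ ts → ResolvesOn (node ts) S Y →
               EdgeClosed (_∈ leaves t) S Y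
child-closed {t = t} uniq t∈ res (edge t′∈S t′⊆Y) with res t′∈S t′⊆Y
... | w , w≺ , a∈w , b∈w , _ with ≺-child w≺
...   | t₂ , t₂∈ , w⊆t₂ = mk⇔ (λ a∈t → move a∈t a∈w b∈w) (λ b∈t → move b∈t b∈w a∈w)
  where
  move : ∀ {x y} → x ∈ leaves t → x ∈ leaves w → y ∈ leaves w → y ∈ leaves t
  move x∈t x∈w y∈w with refl ← same-child uniq t∈ t₂∈ x∈t (w⊆t₂ x∈w) = w⊆t₂ y∈w

-- Aho et al.: a tree displaying S on Y has a cluster that is a proper union of components of [S, Y].
aho-cluster : ∀ T {S Y y₀ y₁} → Unique (leaves T) → Y ⊆ leaves T → ResolvesOn T S Y →
              y₀ ∈ Y → y₁ ∈ Y → y₀ ≢ y₁ →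
              ∃[ v ] (v ≺ T × y₀ ∈ leaves v × (∃[ y ] (y ∈ Y × y ∉ leaves v)) × EdgeClosed (_∈ leaves v) S Y)
aho-cluster (leaf _) _ Y⊆ _ y₀∈ y₁∈ y₀≢y₁ with Y⊆ y₀∈ | Y⊆ y₁∈
... | here refl | here refl = ⊥-elim (y₀≢y₁ refl)
aho-cluster (node ts) {S} {Y} {y₀} uniq Y⊆ res y₀∈ y₁∈ y₀≢y₁ = search ts (λ m → m) (Y⊆ y₀∈)
  where
  search : ∀ ts′ → (∀ {t} → t ∈ ts′ → t ∈ ts) → y₀ ∈ leavesF ts′ →
           ∃[ v ] (v ≺ node ts × y₀ ∈ leaves v × (∃[ y ] (y ∈ Y × y ∉ leaves v)) × EdgeClosed (_∈ leaves v) S Y)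
  search (t ∷ ts′) sub y₀∈ts′ with ∈-++⁻ (leaves t) y₀∈ts′
  ... | inj₂ y₀∈rest = search ts′ (λ m → sub (there m)) y₀∈rest
  ... | inj₁ y₀∈t with Y ⊆? leaves t
  ...   | no Y⊈t  = t , child (sub (here refl)) , y₀∈t , ⊈⇒∃∉ Y⊈t , child-closed uniq (sub (here refl)) res
  ...   | yes Y⊆t =
    let t∈ = sub (here refl)
        res-t = resolvesOn-below uniq (inj₂ (child t∈)) Y⊆t res
        v , v≺t , rest = aho-cluster t (child-unique uniq t∈) Y⊆t res-t y₀∈ y₁∈ y₀≢y₁
    in v , deeper v≺t t∈ , rest

witness⇒separating : ∀ {S Y x T} → Witness S Y x → Unique (leaves T) → Y ⊆ leaves T → ResolvesOn T S Y →
                     HasSeparatingCluster T x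
witness⇒separating {x = x} {T} (x⊆Y , a~b , anchored) uniq Y⊆T res =
  let v , v≺ , a∈v , (y , y∈Y , y∉v) , closed =
        aho-cluster T uniq Y⊆T res (a∈ x⊆Y) (c∈ x⊆Y) (≢-sym (c≢a x))
      b∈v = connected-closed closed a~b a∈v
  in v , v≺ , a∈v , b∈v , λ c∈v → y∉v (reaches-closure closed (leavesOf-all a∈v b∈v c∈v) (anchored y∈Y))

anchored-⊆-child : ∀ {ts t S Z x} → Unique (leavesF ts) → ResolvesOn (node ts) S Z → Anchored S Z x →
                   leavesOf x ⊆ leaves t → t ∈ ts → Z ⊆ leaves t
anchored-⊆-child uniq res anchored x⊆t t∈ z∈Z = reaches-closure (child-closed uniq t∈ res) x⊆t (anchored z∈Z)

anchored-⊆ : ∀ {T v S Z x} → Unique (leaves T) → ResolvesOn T S Z → Z ⊆ leaves T → Anchored S Z x →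
             leavesOf x ⊆ leaves v → v ⪯ T → Z ⊆ leaves v
anchored-⊆ _    _   Z⊆T _        _   (inj₁ refl)         = Z⊆T
anchored-⊆ uniq res _   anchored x⊆v (inj₂ (child v∈)) = anchored-⊆-child uniq res anchored x⊆v v∈
anchored-⊆ uniq res _   anchored x⊆v (inj₂ (deeper v≺u u∈)) =
  let Z⊆u = anchored-⊆-child uniq res anchored (λ m → ≺-leaves v≺u (x⊆v m)) u∈
      res-u = resolvesOn-below uniq (inj₂ (child u∈)) Z⊆u res
  in anchored-⊆ (child-unique uniq u∈) res-u Z⊆u anchored x⊆v (inj₂ v≺u)

anchored-transfer : ∀ {A S Y x} → (∀ {t} → t ∈ A → t ∈ S ⊎ t ≡ x) → Anchored A Y x → Anchored S Y x
anchored-transfer {A} {S} {Y} {x} A⊆S+x anchored y∈Y =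
  reaches-closure closed (λ m → lose m connected-refl) (anchored y∈Y)
  where
  closed : EdgeClosed (Reaches S Y (leavesOf x)) A Y
  closed (edge t∈A t⊆Y) with A⊆S+x t∈A
  ... | inj₁ t∈S  = reaches-closed (edge t∈S t⊆Y)
  ... | inj₂ refl = mk⇔ (λ _ → lose (b∈ λ m → m) connected-refl) (λ _ → lose (a∈ λ m → m) connected-refl)

-- Building trees

record TreeFor (S : TripleSet) (Y : List Label) (T : Tree) : Set where
  field
    leaves⊆   : leaves T ⊆ Y
    ⊆leaves   : Y ⊆ leaves T
    unique    : Unique (leaves T)
    branching : WellBranched T
    resolves  : ResolvesOn T S Y

leaf-treeFor : ∀ {S y} → TreeFor S (y ∷ []) (leaf y)
leaf-treeFor = record
  { leaves⊆ = λ m → m ; ⊆leaves = λ m → m ; unique = [] ∷ [] ; branching = leaf _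
  ; resolves = λ {t} _ t⊆y → ⊥-elim (a≢b t (trans (singleton (a∈ t⊆y)) (sym (singleton (b∈ t⊆y)))))
  }
  where
  singleton : ∀ {x y} → x ∈ y ∷ [] → x ≡ y
  singleton (here x≡y) = x≡y

-- A triple whose a and c lie on different sides of W is separated by the subtree on a's side.
join-resolves : ∀ {S Y W T₁ T₂} → EdgeClosed (_∈ W) S Y → TreeFor S (Y ∩ W) T₁ → TreeFor S (Y ∖ W) T₂ →
                ResolvesOn (node (T₁ ∷ T₂ ∷ [])) S Y
join-resolves {W = W} closed tf₁ tf₂ {t} t∈S t⊆Y with a t ∈? W | c t ∈? W | closed (edge t∈S t⊆Y)
... | yes a∈W | yes c∈W | a∈W⇔b∈W =
  let b∈W = Equivalence.to a∈W⇔b∈W a∈W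
      v , v≺ , separates = TreeFor.resolves tf₁ t∈S
                             (leavesOf-all (∈-∩⁺ (a∈ t⊆Y) a∈W) (∈-∩⁺ (b∈ t⊆Y) b∈W) (∈-∩⁺ (c∈ t⊆Y) c∈W))
  in v , deeper v≺ (here refl) , separates
... | yes a∈W | no c∉W | a∈W⇔b∈W =
  _ , child (here refl)
    , TreeFor.⊆leaves tf₁ (∈-∩⁺ (a∈ t⊆Y) a∈W)
    , TreeFor.⊆leaves tf₁ (∈-∩⁺ (b∈ t⊆Y) (Equivalence.to a∈W⇔b∈W a∈W))
    , λ c∈T₁ → c∉W (proj₂ (∈-∩⁻ (TreeFor.leaves⊆ tf₁ c∈T₁)))
... | no a∉W | yes c∈W | a∈W⇔b∈W =
  _ , child (there (here refl))
    , TreeFor.⊆leaves tf₂ (∈-∖⁺ (a∈ t⊆Y) a∉W)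
    , TreeFor.⊆leaves tf₂ (∈-∖⁺ (b∈ t⊆Y) (a∉W ∘ Equivalence.from a∈W⇔b∈W))
    , λ c∈T₂ → proj₂ (∈-∖⁻ (TreeFor.leaves⊆ tf₂ c∈T₂)) c∈W
... | no a∉W | no c∉W | a∈W⇔b∈W =
  let b∉W = a∉W ∘ Equivalence.from a∈W⇔b∈W
      v , v≺ , separates = TreeFor.resolves tf₂ t∈S
                             (leavesOf-all (∈-∖⁺ (a∈ t⊆Y) a∉W) (∈-∖⁺ (b∈ t⊆Y) b∉W) (∈-∖⁺ (c∈ t⊆Y) c∉W))
  in v , deeper v≺ (there (here refl)) , separates

join : ∀ {S Y W T₁ T₂} → EdgeClosed (_∈ W) S Y → TreeFor S (Y ∩ W) T₁ → TreeFor S (Y ∖ W) T₂ →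
       TreeFor S Y (node (T₁ ∷ T₂ ∷ []))
join {Y = Y} {W} {T₁} {T₂} closed tf₁ tf₂ = record
  { leaves⊆   = leaves⊆
  ; ⊆leaves   = ⊆leaves
  ; unique    = Unique.++⁺ T₁.unique (Unique.++⁺ T₂.unique [] λ ()) disjoint
  ; branching = node (s≤s (s≤s z≤n)) (T₁.branching ∷ T₂.branching ∷ [])
  ; resolves  = join-resolves closed tf₁ tf₂
  }
  where
  module T₁ = TreeFor tf₁
  module T₂ = TreeFor tf₂

  leaves⊆ : leaves T₁ ++ (leaves T₂ ++ []) ⊆ Y
  leaves⊆ m with ∈-++⁻ (leaves T₁) m
  ... | inj₁ m₁ = proj₁ (∈-∩⁻ (T₁.leaves⊆ m₁))
  ... | inj₂ m₂ with ∈-++⁻ (leaves T₂) m₂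
  ...   | inj₁ m₂′ = proj₁ (∈-∖⁻ (T₂.leaves⊆ m₂′))

  ⊆leaves : Y ⊆ leaves T₁ ++ (leaves T₂ ++ [])
  ⊆leaves {y} y∈Y with y ∈? W
  ... | yes y∈W = ∈-++⁺ˡ (T₁.⊆leaves (∈-∩⁺ y∈Y y∈W))
  ... | no y∉W  = ∈-++⁺ʳ (leaves T₁) (∈-++⁺ˡ (T₂.⊆leaves (∈-∖⁺ y∈Y y∉W)))

  disjoint : ∀ {y} → ¬ (y ∈ leaves T₁ × y ∈ leaves T₂ ++ [])
  disjoint (m₁ , m₂) with ∈-++⁻ (leaves T₂) m₂
  ... | inj₁ m₂′ = proj₂ (∈-∖⁻ (T₂.leaves⊆ m₂′)) (proj₂ (∈-∩⁻ (T₁.leaves⊆ m₁)))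

join-clusters : ∀ {S Y W T₁ T₂ v u w} → TreeFor S (Y ∩ W) T₁ → TreeFor S (Y ∖ W) T₂ →
                v ≺ node (T₁ ∷ T₂ ∷ []) → u ∈ leaves v → w ∈ leaves v → u ∈ W → w ∈ W
join-clusters tf₁ tf₂ v≺ u∈v w∈v u∈W with ≺-child v≺
... | _ , here refl         , v⊆ = proj₂ (∈-∩⁻ (TreeFor.leaves⊆ tf₁ (v⊆ w∈v)))
... | _ , there (here refl) , v⊆ = ⊥-elim (proj₂ (∈-∖⁻ (TreeFor.leaves⊆ tf₂ (v⊆ u∈v))) u∈W)

-- The splits of Aho's BUILD algorithm are read off the clusters of a fixed tree T₀ displaying the triples.
module Construction (T₀ : Tree) (unique₀ : Unique (leaves T₀)) where

  aho-split : ∀ {S Y y₀ y₁} → DisplaysAll T₀ S → Y ⊆ leaves T₀ → y₀ ∈ Y → y₁ ∈ Y → y₀ ≢ y₁ →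
              ∃[ W ] (EdgeClosed (_∈ W) S Y × y₀ ∈ W × ∃[ y ] (y ∈ Y × y ∉ W))
  aho-split disp Y⊆ y₀∈ y₁∈ y₀≢y₁ =
    let v , _ , y₀∈v , outside , closed =
          aho-cluster T₀ unique₀ Y⊆ (displaysAll⇒resolvesOn disp) y₀∈ y₁∈ y₀≢y₁
    in leaves v , closed , y₀∈v , outside

  not-all-connected : ∀ {S Y y₀ y₁ z} → DisplaysAll T₀ S → Y ⊆ leaves T₀ → y₀ ∈ Y → y₁ ∈ Y → y₀ ≢ y₁ →
                      ¬ (∀ {y} → y ∈ Y → Connected S Y y z)
  not-all-connected disp Y⊆ y₀∈ y₁∈ y₀≢y₁ all~z =
    let W , closed , y₀∈W , y , y∈Y , y∉W = aho-split disp Y⊆ y₀∈ y₁∈ y₀≢y₁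
    in y∉W (connected-closed closed (connected-trans (all~z y₀∈) (connected-sym (all~z y∈Y))) y₀∈W)

  build : ∀ {S Y y} → DisplaysAll T₀ S → Y ⊆ leaves T₀ → Unique Y → y ∈ Y → ∃[ T ] TreeFor S Y T
  build {S} disp = go (<-wellFounded _)
    where
    go : ∀ {Y y} → Acc _<_ (length Y) → Y ⊆ leaves T₀ → Unique Y → y ∈ Y → ∃[ T ] TreeFor S Y T
    go {y ∷ []} _ _ _ _ = leaf y , leaf-treeFor
    go {y₀ ∷ y₁ ∷ Y} (acc rs) Y⊆ uY@((y₀≢y₁ ∷ _) ∷ _) _ =
      let W , closed , y₀∈W , y , y∈Y , y∉W = aho-split disp Y⊆ (here refl) (there (here refl)) y₀≢y₁
          T₁ , tf₁ = go (rs (length-∩ y∈Y y∉W)) (λ m → Y⊆ (proj₁ (∈-∩⁻ m))) (∩-unique uY)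
                        (∈-∩⁺ (here refl) y₀∈W)
          T₂ , tf₂ = go (rs (length-∖ (here refl) y₀∈W)) (λ m → Y⊆ (proj₁ (∈-∖⁻ m))) (∖-unique uY)
                        (∈-∖⁺ y∈Y y∉W)
      in node (T₁ ∷ T₂ ∷ []) , join closed tf₁ tf₂

  -- Repeatedly keeping only the components of [S, Y] that meet x's leaves ends in a leaf set on which
  -- x is anchored; the trees built for the discarded parts nest any tree for it inside one for Y.
  record AnchoredCore (S : TripleSet) (Y : List Label) (x : Triple) : Set where
    field
      core        : List Label
      core⊆       : core ⊆ Y
      core-unique : Unique core
      leaves⊆core : leavesOf x ⊆ core
      anchored    : Anchored S core x
      extend      : ∀ {T′} → TreeFor S core T′ → ∃[ T ] (TreeFor S Y T × T′ ⪯ T)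

  anchored-core : ∀ {S Y x} → DisplaysAll T₀ S → Y ⊆ leaves T₀ → Unique Y → leavesOf x ⊆ Y →
                  Classically (AnchoredCore S Y x)
  anchored-core {S} {x = x} disp = go (<-wellFounded _)
    where
    go : ∀ {Y} → Acc _<_ (length Y) → Y ⊆ leaves T₀ → Unique Y → leavesOf x ⊆ Y → Classically (AnchoredCore S Y x)
    go {Y} (acc rs) Y⊆ uY x⊆Y = do
      W , closed , W⊆reach , reach⊆W ← closed-part (reaches-closed {S} {Y} {leavesOf x})
      yes outside ← pure (any? (_∉? W) Y)
        where no none → pure record
                { core = Y ; core⊆ = λ m → m ; core-unique = uY ; leaves⊆core = x⊆Y
                ; anchored = λ y∈Y → W⊆reach (decidable-stable (_ ∈? W) (none ∘ lose y∈Y))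
                ; extend = λ tf → _ , tf , inj₁ refl
                }
      let y , y∈Y , y∉W = find outside
          T₂ , tf₂ = build disp (λ m → Y⊆ (proj₁ (∈-∖⁻ m))) (∖-unique uY) (∈-∖⁺ y∈Y y∉W)
      inner ← go (rs (length-∩ y∈Y y∉W)) (λ m → Y⊆ (proj₁ (∈-∩⁻ m))) (∩-unique uY)
                 (λ m → ∈-∩⁺ (x⊆Y m) (reach⊆W (x⊆Y m) (lose m connected-refl)))
      let open AnchoredCore inner
      pure record
        { core = core ; core⊆ = λ m → proj₁ (∈-∩⁻ (core⊆ m)) ; core-unique = core-unique
        ; leaves⊆core = leaves⊆core ; anchored = anchored
        ; extend = λ tf′ → let T₁ , tf₁ , T′⪯T₁ = extend tf′
                           in node (T₁ ∷ T₂ ∷ []) , join closed tf₁ tf₂ , inj₂ (⪯-child T′⪯T₁ (here refl))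
        }

  build-split : ∀ {S Y W y₁ y₂} → DisplaysAll T₀ S → Y ⊆ leaves T₀ → Unique Y → EdgeClosed (_∈ W) S Y →
                y₁ ∈ Y → y₁ ∈ W → y₂ ∈ Y → y₂ ∉ W →
                ∃[ T ] (TreeFor S Y T × (∀ {v u w} → v ≺ T → u ∈ leaves v → w ∈ leaves v → u ∈ W → w ∈ W))
  build-split disp Y⊆ uY closed y₁∈Y y₁∈W y₂∈Y y₂∉W =
    let T₁ , tf₁ = build disp (λ m → Y⊆ (proj₁ (∈-∩⁻ m))) (∩-unique uY) (∈-∩⁺ y₁∈Y y₁∈W)
        T₂ , tf₂ = build disp (λ m → Y⊆ (proj₁ (∈-∖⁻ m))) (∖-unique uY) (∈-∖⁺ y₂∈Y y₂∉W)
    in node (T₁ ∷ T₂ ∷ []) , join closed tf₁ tf₂ , join-clusters tf₁ tf₂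

-- Closure and representative subsets

InSpanOver : TripleSet → TripleSet → Tree → Set
InSpanOver L S T = IsRootedTree T × (∀ x → x ∈ leaves T ⇔ x ∈L L) × DisplaysAll T S

displays-leaves : ∀ {T t} → Displays T t → leavesOf t ⊆ leaves T
displays-leaves ((a∈T , b∈T , c∈T) , _) = leavesOf-all a∈T b∈T c∈T

treeFor⇒inSpan : ∀ {L S T t} → S ⊆ L → t ∈ L → TreeFor S (labels L) T → InSpanOver L S T
treeFor⇒inSpan {t = t} S⊆L t∈L tf =
  record { rootInner = two-leaves⇒node (⊆leaves (a∈ t⊆L)) (⊆leaves (b∈ t⊆L)) (a≢b t)
         ; branching = branching ; leavesUnique = unique }
  , (λ _ → mk⇔ (λ m → Equivalence.from ∈L⇔∈labels (leaves⊆ m))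
               (λ m → ⊆leaves (Equivalence.to ∈L⇔∈labels m)))
  , λ s∈S → let s⊆L = ∈-labels⁺ (S⊆L s∈S)
            in (⊆leaves (a∈ s⊆L) , ⊆leaves (b∈ s⊆L) , ⊆leaves (c∈ s⊆L)) , resolves s∈S s⊆L
  where
  open TreeFor tf
  t⊆L = ∈-labels⁺ t∈L

no-empty-span : ∀ {T} → IsRootedTree T → ¬ (∀ x → x ∈ leaves T ⇔ x ∈L [])
no-empty-span rooted leaves⇔ with wellBranched-leaf (IsRootedTree.branching rooted)
... | x , x∈T with Equivalence.to (leaves⇔ x) x∈T
...   | _ , () , _

module Closure (R : TripleSet) {T₀ : Tree} (T₀-rooted : IsRootedTree T₀) (R-displayed : DisplaysAll T₀ R) where

  open Construction T₀ (IsRootedTree.leavesUnique T₀-rooted)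
  open ListOps _≟ₜ_ using (remove; ∈-remove⁺; ∈-remove⁻; remove-unique)
  open BasisExchange _≟ₜ_ (Representative R) proj₁ using (ExchangeProperty)

  displayed : ∀ {S} → S ⊆ R → DisplaysAll T₀ S
  displayed S⊆R t∈S = R-displayed (S⊆R t∈S)

  labels⊆leaves₀ : labels R ⊆ leaves T₀
  labels⊆leaves₀ m = let _ , t∈R , y∈t = ∈-labels⁻ m in displays-leaves (R-displayed t∈R) y∈t

  -- The closure of S relative to trees on the leaf set of R (InCl S uses the leaf set of S).
  Cl : TripleSet → Triple → Set
  Cl S t = ∀ T → InSpanOver R S T → Displays T t

  cl-mono : ∀ {S S′ t} → S ⊆ S′ → Cl S t → Cl S′ t
  cl-mono S⊆S′ cl T (rooted , leaves⇔ , disp) = cl T (rooted , leaves⇔ , λ t∈S → disp (S⊆S′ t∈S))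

  cl-self : ∀ {S t} → t ∈ S → Cl S t
  cl-self t∈S _ (_ , _ , disp) = disp t∈S

  cl-trans : ∀ {S A t} → (∀ {s} → s ∈ A → Cl S s) → Cl A t → Cl S t
  cl-trans A⊆clS cl T span@(rooted , leaves⇔ , _) = cl T (rooted , leaves⇔ , λ s∈A → A⊆clS s∈A T span)

  span-tree : ∀ {S t} → S ⊆ R → t ∈ S → ∃[ T ] InSpanOver S S T
  span-tree S⊆R t∈S =
    let T , tf = build (displayed S⊆R) (λ m → labels⊆leaves₀ (labels-mono S⊆R m)) (labels-unique _)
                       (a∈ (∈-labels⁺ t∈S))
    in T , treeFor⇒inSpan (λ m → m) t∈S tf

  witness⇒cl : ∀ {S Y x} → Y ⊆ labels R → Witness S Y x → Cl S x
  witness⇒cl Y⊆ w@(x⊆Y , _) T (rooted , leaves⇔ , disp) =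
    (Y⊆T (a∈ x⊆Y) , Y⊆T (b∈ x⊆Y) , Y⊆T (c∈ x⊆Y))
    , witness⇒separating w (IsRootedTree.leavesUnique rooted) Y⊆T (displaysAll⇒resolvesOn disp)
    where
    Y⊆T : _ ⊆ leaves T
    Y⊆T m = Equivalence.from (leaves⇔ _) (Equivalence.from ∈L⇔∈labels (Y⊆ m))

  -- If a and b were not connected on the anchored core, splitting it between them would give a tree
  -- in the span that does not display x.
  cl⇒witness : ∀ {S x} → S ⊆ R → x ∈ R → Cl S x → Classically (∃[ Y ] (Y ⊆ labels R × Witness S Y x))
  cl⇒witness {S} {x} S⊆R x∈R cl = do
    K ← anchored-core (displayed S⊆R) labels⊆leaves₀ (labels-unique R) (∈-labels⁺ x∈R)
    let open AnchoredCore K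
    yes a~b ← excluded-middle {A = Connected S core (a x) (b x)}
      where no ¬a~b → do
        W , closed , W⊆ , ⊆W ← closed-part (connectedTo-closed {S} {core} {a x})
        let a∈W = ⊆W (a∈ leaves⊆core) connected-refl
            b∉W = λ b∈W → ¬a~b (connected-sym (W⊆ b∈W))
            T′ , tf′ , within = build-split (displayed S⊆R) (λ m → labels⊆leaves₀ (core⊆ m)) core-unique closed
                                            (a∈ leaves⊆core) a∈W (b∈ leaves⊆core) b∉W
            T , tf , T′⪯T = extend tf′
            v , v≺ , a∈v , b∈v , _ = separating-below (TreeFor.unique tf) T′⪯T
                                       (λ m → TreeFor.⊆leaves tf′ (leaves⊆core m))
                                       (proj₂ (cl T (treeFor⇒inSpan S⊆R x∈R tf)))
        ⊥-elim (b∉W (within v≺ a∈v b∈v a∈W))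
    pure (core , core⊆ , leaves⊆core , a~b , anchored)

  -- A tree in the span of S displays S′, so anchored-⊆ pushes Z into the subtree built on the core.
  anchored-extends : ∀ {S S′ Z x} → S ⊆ R → (∀ {s} → s ∈ S′ → Cl S s) → x ∈ R → Z ⊆ labels R → Anchored S′ Z x →
                     Classically (∃[ Y ] (Y ⊆ labels R × Z ⊆ Y × Anchored S Y x))
  anchored-extends {S} {S′} {Z} S⊆R S′⊆clS x∈R Z⊆ anchoredZ = do
    K ← anchored-core (displayed S⊆R) labels⊆leaves₀ (labels-unique R) (∈-labels⁺ x∈R)
    let open AnchoredCore K
        T′ , tf′ = build (displayed S⊆R) (λ m → labels⊆leaves₀ (core⊆ m)) core-unique (a∈ leaves⊆core)
        T , tf , T′⪯T = extend tf′
        span = treeFor⇒inSpan S⊆R x∈R tf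
        Z⊆T′ = anchored-⊆ (TreeFor.unique tf) (λ s∈S′ _ → proj₂ (S′⊆clS s∈S′ T span))
                          (λ m → TreeFor.⊆leaves tf (Z⊆ m)) anchoredZ
                          (λ m → TreeFor.⊆leaves tf′ (leaves⊆core m)) T′⪯T
    pure (core , core⊆ , (λ m → TreeFor.leaves⊆ tf′ (Z⊆T′ m)) , anchored)

  -- A witness avoiding c would leave Y ∖ {c} connected by the triples of S, contradicting Aho's lemma.
  witness-labels : ∀ {S Y x} → S ⊆ R → Y ⊆ labels R → Witness S Y x → leavesOf x ⊆ labels S
  witness-labels {S} {Y} {x} S⊆R Y⊆ (x⊆Y , a~b , anchored) =
    leavesOf-all (connected-endpoint a~b (a≢b x)) (connected-endpoint (connected-sym a~b) (≢-sym (a≢b x))) c∈S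
    where
    c∈S : c x ∈ labels S
    c∈S with c x ∈? labels S
    ... | yes c∈ = c∈
    ... | no c∉ = ⊥-elim (not-all-connected (displayed S⊆R) (λ m → labels⊆leaves₀ (Y⊆ (proj₁ (∈-∖⁻ m))))
                                            (without-c (a∈ x⊆Y) (c≢a x ∘ sym))
                                            (without-c (b∈ x⊆Y) (c≢b x ∘ sym))
                                            (a≢b x) connected-to-a)
      where
      Y′ = Y ∖ (c x ∷ [])
      without-c : ∀ {y} → y ∈ Y → y ≢ c x → y ∈ Y′
      without-c y∈Y y≢c = ∈-∖⁺ y∈Y λ { (here y≡c) → y≢c y≡c }
      avoid : ∀ {u v} → Connected S Y u v → Connected S Y′ u v
      avoid = EqClosure.map λ { (edge {t} t∈S t⊆Y) →
        edge t∈S (λ m → without-c (t⊆Y m) λ { refl → c∉ (∈-labels⁺ t∈S m) }) }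
      connected-to-a : ∀ {y} → y ∈ Y′ → Connected S Y′ y (a x)
      connected-to-a y∈Y′ with ∈-∖⁻ y∈Y′
      ... | y∈Y , y∉[c] with find (anchored y∈Y)
      ...   | z , z∈x , y~z with ∈-leavesOf⁻ z∈x
      ...     | inj₁ refl        = avoid y~z
      ...     | inj₂ (inj₁ refl) = avoid (connected-trans y~z (connected-sym a~b))
      ...     | inj₂ (inj₂ refl) =
        ⊥-elim (c∉ (connected-endpoint (connected-sym y~z) λ c≡y → y∉[c] (here (sym c≡y))))

  Generating : TripleSet → Set
  Generating S = Unique S × S ⊆ R × (∀ {t} → t ∈ R → Cl S t)

  generating-labels : ∀ {S} → Generating S → labels R ⊆ labels S
  generating-labels {S} (_ , S⊆R , cl) {y} m =
    let t , t∈R , y∈t = ∈-labels⁻ m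
    in classically-stable (y ∈? labels S) do
         Y , Y⊆ , w ← cl⇒witness S⊆R t∈R (cl t∈R)
         pure (witness-labels S⊆R Y⊆ w y∈t)

  -- For S = [] the span is empty, so the closure contains every triple; but no tree displays
  -- both ab|c and ac|b.
  representative-labels : ∀ {S} → Representative R S → labels R ⊆ labels S
  representative-labels {[]} (_ , _ , cl⇔) m =
    let t , t∈R , _ = ∈-labels⁻ m
        t′ , ac⊆ , c≡b = regroup t
        T , span@(rooted , _ , disp) = span-tree (λ m → m) t∈R
        t′-displayed = Equivalence.to (cl⇔ t′) (λ _ (rooted′ , leaves⇔ , _) → ⊥-elim (no-empty-span rooted′ leaves⇔))
                                      T span
    in ⊥-elim (separating-conflict {x = t} {y = t′} (IsRootedTree.leavesUnique rooted) ac⊆ c≡b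
                                   (proj₂ (disp t∈R)) (proj₂ t′-displayed))
  representative-labels {_ ∷ _} (_ , S⊆R , cl⇔) m =
    let t , t∈R , y∈t = ∈-labels⁻ m
        T , span@(_ , leaves⇔ , _) = span-tree S⊆R (here refl)
        t-displayed = Equivalence.from (cl⇔ t) (λ _ (_ , _ , disp) → disp t∈R) T span
    in Equivalence.to ∈L⇔∈labels (Equivalence.to (leaves⇔ _) (displays-leaves t-displayed y∈t))

  ∈L-swap : ∀ {S} → S ⊆ R → labels R ⊆ labels S → ∀ y → y ∈L S ⇔ y ∈L R
  ∈L-swap S⊆R R⊆S _ =
    mk⇔ (λ m → Equivalence.from ∈L⇔∈labels (labels-mono S⊆R (Equivalence.to ∈L⇔∈labels m)))
        (λ m → Equivalence.from ∈L⇔∈labels (R⊆S (Equivalence.to ∈L⇔∈labels m)))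

  representative⇒generating : ∀ {S} → Representative R S → Generating S
  representative⇒generating rep@(uS , S⊆R , cl⇔) = uS , S⊆R , λ {t} t∈R T (rooted , leaves⇔ , disp) →
    Equivalence.from (cl⇔ t) (λ _ (_ , _ , dispR) → dispR t∈R) T
      (rooted , (λ y → ⇔-sym (∈L-swap S⊆R (representative-labels rep) y) ⇔-∘ leaves⇔ y) , disp)

  generating⇒representative : ∀ {S} → Generating S → Representative R S
  generating⇒representative gen@(uS , S⊆R , cl) = uS , S⊆R , λ t → mk⇔
    (λ t∈clS T (rooted , leaves⇔ , dispR) →
       t∈clS T (rooted , (λ y → ⇔-sym (swap y) ⇔-∘ leaves⇔ y) , λ s∈S → dispR (S⊆R s∈S)))
    (λ t∈clR T (rooted , leaves⇔ , dispS) →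
       let leaves⇔R = λ y → swap y ⇔-∘ leaves⇔ y
       in t∈clR T (rooted , leaves⇔R , λ r∈R → cl r∈R T (rooted , leaves⇔R , dispS)))
    where
    swap = ∈L-swap S⊆R (generating-labels gen)

  generating-from : ∀ {A S x} → Generating A → Unique S → S ⊆ R → Cl S x →
                    (∀ {t} → t ∈ A → t ≢ x → t ∈ S) → Generating S
  generating-from {A} {S} {x} (_ , _ , clA) uS S⊆R clSx A∖x⊆S =
    uS , S⊆R , λ {r} r∈R → cl-trans {t = r} A⊆clS (clA r∈R)
    where
    A⊆clS : ∀ {t} → t ∈ A → Cl S t
    A⊆clS {t} t∈A with t ≟ₜ x
    ... | yes refl = clSx
    ... | no t≢x   = cl-self (A∖x⊆S t∈A t≢x)

  module Exchange {A B x} (genA : Generating A) (¬genS : ¬ Generating (remove x A)) (genB : Generating B)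
                  (x∈A : x ∈ A) (x∉B : x ∉ B) where

    S = remove x A
    U = S ++ B

    A⊆R = proj₁ (proj₂ genA)
    B⊆R = proj₁ (proj₂ genB)

    S⊆R : S ⊆ R
    S⊆R m = A⊆R (proj₁ (∈-remove⁻ m))

    U⊆R : U ⊆ R
    U⊆R m with ∈-++⁻ S m
    ... | inj₁ m∈S = S⊆R m∈S
    ... | inj₂ m∈B = B⊆R m∈B

    U⊆clA : ∀ {t} → t ∈ U → Cl A t
    U⊆clA m with ∈-++⁻ S m
    ... | inj₁ m∈S = cl-self (proj₁ (∈-remove⁻ m∈S))
    ... | inj₂ m∈B = proj₂ (proj₂ genA) (B⊆R m∈B)

    A⊆S+x : ∀ {t} → t ∈ A → t ∈ S ⊎ t ≡ x
    A⊆S+x {t} t∈A with t ≟ₜ x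
    ... | yes t≡x = inj₂ t≡x
    ... | no t≢x  = inj₁ (∈-remove⁺ t∈A t≢x)

    A⊆U+x : ∀ {t} → t ∈ A → t ∈ U ⊎ t ≡ x
    A⊆U+x t∈A with A⊆S+x t∈A
    ... | inj₁ t∈S = inj₁ (∈-++⁺ˡ t∈S)
    ... | inj₂ t≡x = inj₂ t≡x

    module _ {Y} (Y⊆ : Y ⊆ labels R) (x⊆Y : leavesOf x ⊆ Y) (anchoredA : Anchored A Y x)
             (a~b-U : Connected U Y (a x) (b x)) where

      anchoredS : Anchored S Y x
      anchoredS = anchored-transfer A⊆S+x anchoredA

      ¬a~c-U : ¬ Connected U Y (a x) (c x)
      ¬a~c-U a~c = not-all-connected (displayed U⊆R) (λ m → labels⊆leaves₀ (Y⊆ m)) (a∈ x⊆Y) (c∈ x⊆Y)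
                                     (≢-sym (c≢a x)) connected-to-a
        where
        connected-to-a : ∀ {y} → y ∈ Y → Connected U Y y (a x)
        connected-to-a y∈Y =
          reaches-closure connectedTo-closed (leavesOf-all connected-refl (connected-sym a~b-U) (connected-sym a~c))
                          (anchored-transfer A⊆U+x anchoredA y∈Y)

      -- Otherwise A ∖ {x} would generate x, and hence all of R.
      ¬a~b-S : ¬ Connected S Y (a x) (b x)
      ¬a~b-S a~b = ¬genS (generating-from genA (remove-unique (proj₁ genA)) S⊆R
                                          (witness⇒cl Y⊆ (x⊆Y , a~b , anchoredS)) ∈-remove⁺)

      -- An edge of U leaving the S-component of a comes from a triple t ∈ B, and joins it to the
      -- S-component of b (that of c is excluded by ¬a~c-U), so t ∷ S generates x.
      replacement : ∀ {d e} → SymClosure (AhoEdge U Y) d e → Connected S Y d (a x) → ¬ Connected S Y e (a x) →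
                    ∃[ t ] (t ∈ B × Generating (t ∷ S))
      replacement d–e d~a ¬e~a with edge-source d–e
      ... | t , t∈U , t-edge =
        t , t∈B , generating-from genA (All.¬Any⇒All¬ S t∉S ∷ remove-unique (proj₁ genA)) t∷S⊆R
                                  (witness⇒cl Y⊆ (x⊆Y , a~b , anchored)) (λ t∈A t≢x → there (∈-remove⁺ t∈A t≢x))
        where
        t∉S : t ∉ S
        t∉S t∈S = ¬e~a (connected-trans (connected-sym (edge-connected t∈S t-edge)) d~a)

        t∈B : t ∈ B
        t∈B with ∈-++⁻ S t∈U
        ... | inj₁ t∈S = ⊥-elim (t∉S t∈S)
        ... | inj₂ t∈B = t∈B

        t∷S⊆R : t ∷ S ⊆ R
        t∷S⊆R (here refl) = B⊆R t∈B
        t∷S⊆R (there m)   = S⊆R m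

        S⊆U : ∀ {u v} → Connected S Y u v → Connected U Y u v
        S⊆U = connected-mono ∈-++⁺ˡ (λ m → m)

        e~b : Connected S Y _ (b x)
        e~b with find (anchoredS (edge-target-∈ d–e))
        ... | z , z∈x , e~z with ∈-leavesOf⁻ z∈x
        ...   | inj₁ refl        = ⊥-elim (¬e~a e~z)
        ...   | inj₂ (inj₁ refl) = e~z
        ...   | inj₂ (inj₂ refl) = ⊥-elim (¬a~c-U (connected-trans (S⊆U (connected-sym d~a))
                                           (connected-trans (edge-connected (∈-++⁺ʳ S t∈B) t-edge) (S⊆U e~z))))

        a~b : Connected (t ∷ S) Y (a x) (b x)
        a~b = connected-trans (connected-mono there (λ m → m) (connected-sym d~a))
                (connected-trans (edge-connected (here refl) t-edge) (connected-mono there (λ m → m) e~b))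

        anchored : Anchored (t ∷ S) Y x
        anchored = anchored-transfer (λ m → inj₁ (there m)) anchoredS

  exchange : ∀ {A B x} → Generating A → ¬ Generating (remove x A) → Generating B → x ∈ A → x ∉ B →
             Classically (∃[ y ] (y ∈ B × Generating (y ∷ remove x A)))
  exchange {A} {B} {x} genA ¬genS genB x∈A x∉B = do
    let x∈R = A⊆R x∈A
    Z , Z⊆ , x⊆Z , a~b , anchoredZ ← cl⇒witness U⊆R x∈R (cl-mono {t = x} (∈-++⁺ʳ S) (proj₂ (proj₂ genB) x∈R))
    Y , Y⊆ , Z⊆Y , anchoredA ← anchored-extends A⊆R U⊆clA x∈R Z⊆ anchoredZ
    let x⊆Y : leavesOf x ⊆ Y
        x⊆Y m = Z⊆Y (x⊆Z m)
        a~b-U = connected-mono (λ m → m) Z⊆Y a~b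
    _ , _ , d–e , d~a , ¬e~a ← crossing-edge {P = λ y → Connected S Y y (a x)} a~b-U connected-refl
                                        (¬a~b-S Y⊆ x⊆Y anchoredA a~b-U ∘ connected-sym)
    pure (replacement Y⊆ x⊆Y anchoredA a~b-U d–e d~a ¬e~a)
    where open Exchange genA ¬genS genB x∈A x∉B

  representative-exchange : ExchangeProperty
  representative-exchange repX ¬repX∖x repY x∈X x∉Y = do
    y , y∈Y , gen ← exchange (representative⇒generating repX) (¬repX∖x ∘ generating⇒representative)
                             (representative⇒generating repY) x∈X x∉Y
    pure (y , y∈Y , generating⇒representative gen)

mainTheorem2 : (R : TripleSet) → Unique R → Consistent R →
    ∀ R' → (InclMinimal R R' ⇔ MinCard R R')
mainTheorem2 R _ (_ , T₀-rooted , R-displayed) R' = minimal⇔minimum representative-exchange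
  where
  open BasisExchange _≟ₜ_ (Representative R) proj₁ using (minimal⇔minimum)
  open Closure R T₀-rooted R-displayed using (representative-exchange)
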